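{- For every integer $\ell\geq 1$, $$p(4\ell,3,6\ell)-p(4\ell,3,6\ell-1)=1\quad\text{and}\quad p(4\ell-2,3,6\ell-3)=p(4\ell-2,3,6\ell-4).$$
   Context: For nonnegative integers $k,j,n$, $p(k,j,n)$ denotes the number of partitions of $n$ into at most $j$ parts, each part at most $k$. -}

module Defs where

open import Data.Nat using (ℕ; zero; suc; _≟_)
open import Data.List using (List; []; _∷_; map; concatMap; filter; length; upTo)
open import Data.Nat.ListAction using (sum)

-- A partition is represented as a list of positive parts in non-increasing order.
-- boundedLists m j : all non-increasing lists of length at most j whose entries
-- lie in {1, …, m}  (each such list listed exactly once).
boundedLists : ℕ → ℕ → List (List ℕ)
boundedLists m zero    = [] ∷ []
boundedLists m (suc j) =
  [] ∷ concatMap (λ i → map (λ xs → suc i ∷ xs) (boundedLists (suc i) j)) (upTo m)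

p : ℕ → ℕ → ℕ → ℕ
p k j n = length (filter (λ xs → sum xs ≟ n) (boundedLists k j))

-- Raising the largest part of a partition by one gives
--   p(k,3,n+1) − p(k,3,n) = T(k,n+1) − p(k,2,n−k),
-- where T(k,m) counts the partitions b + b + c of m with c ≤ b ≤ k (the two largest parts
-- tie) and p(k,2,n−k) counts those of n with largest part k.  Both counts are numbers of b in an
-- explicit interval: for k = 4ℓ, n = 6ℓ − 1 they are ℓ + 1 and ℓ, and for k = 4ℓ − 2,
-- n = 6ℓ − 4 they are both ℓ.
module Submission where

open import Defs
open import Data.Nat using (ℕ; zero; suc; _+_; _*_; _∸_; _≤_; _<_; _≟_; s≤s)
open import Data.Nat.Properties
open import Data.Nat.ListAction using (sum)
open import Data.Nat.Tactic.RingSolver using (solve; solve-∀)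
open import Data.List using (List; []; _∷_; [_]; _++_; map; concatMap; filter; length; upTo)
open import Data.List.Properties using (filter-++; filter-≐; filter-none; length-++; concatMap-++; ++-identityʳ; upTo-∷ʳ)
open import Data.List.Relation.Unary.All using (universal)
open import Data.Bool using (true; false)
open import Data.Product using (_×_; _,_)
open import Function using (_∘_)
open import Relation.Nullary using (does)
open import Relation.Unary using (Decidable)
open import Relation.Binary.PropositionalEquality using (_≡_; refl; sym; trans; cong; cong₂; subst; subst₂; module ≡-Reasoning)

𝟙[_≤_] : ℕ → ℕ → ℕ
𝟙[ zero  ≤ b     ] = 1
𝟙[ suc m ≤ zero  ] = 0
𝟙[ suc m ≤ suc b ] = 𝟙[ m ≤ b ]

𝟙-≤ : ∀ {n b} → n ≤ b → 𝟙[ n ≤ b ] ≡ 1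
𝟙-≤ {zero}  _         = refl
𝟙-≤ {suc n} (s≤s n≤b) = 𝟙-≤ n≤b

𝟙-> : ∀ {n b} → b < n → 𝟙[ n ≤ b ] ≡ 0
𝟙-> {suc n} {zero}  _         = refl
𝟙-> {suc n} {suc b} (s≤s b<n) = 𝟙-> b<n

shift : ℕ → (ℕ → ℕ) → ℕ → ℕ
shift zero    h n       = h n
shift (suc a) h zero    = 0
shift (suc a) h (suc n) = shift a h n

shift-cong : ∀ a {f g : ℕ → ℕ} → (∀ m → f m ≡ g m) → ∀ n → shift a f n ≡ shift a g n
shift-cong zero    f≗g n       = f≗g n
shift-cong (suc a) f≗g zero    = refl
shift-cong (suc a) f≗g (suc n) = shift-cong a f≗g n

shift-+ : ∀ a (f g : ℕ → ℕ) n → shift a (λ m → f m + g m) n ≡ shift a f n + shift a g n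
shift-+ zero    f g n       = refl
shift-+ (suc a) f g zero    = refl
shift-+ (suc a) f g (suc n) = shift-+ a f g n

shift-shift : ∀ a b h n → shift a (shift b h) n ≡ shift (a + b) h n
shift-shift zero    b h n       = refl
shift-shift (suc a) b h zero    = refl
shift-shift (suc a) b h (suc n) = shift-shift a b h n

shift-at : ∀ a h r → shift a h (a + r) ≡ h r
shift-at zero    h r = refl
shift-at (suc a) h r = shift-at a h r

shift-below : ∀ a h {n} → n < a → shift a h n ≡ 0
shift-below (suc a) h {zero}  _         = refl
shift-below (suc a) h {suc n} (s≤s n<a) = shift-below a h n<a

shift-𝟙-inside : ∀ a b {n} → a ≤ n → n ≤ a + b → shift a (λ r → 𝟙[ r ≤ b ]) n ≡ 1
shift-𝟙-inside zero    b _         n≤b           = 𝟙-≤ n≤b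
shift-𝟙-inside (suc a) b (s≤s a≤n) (s≤s n≤a+b) = shift-𝟙-inside a b a≤n n≤a+b

shift-𝟙-above : ∀ a b {n} → a + b < n → shift a (λ r → 𝟙[ r ≤ b ]) n ≡ 0
shift-𝟙-above zero    b         b<n             = 𝟙-> b<n
shift-𝟙-above (suc a) b {suc n} (s≤s a+b<n) = shift-𝟙-above a b a+b<n

𝟙-≤-suc : ∀ b n → 𝟙[ n ≤ b ] + shift (suc b) (λ m → 𝟙[ m ≤ 0 ]) n ≡ 𝟙[ n ≤ suc b ]
𝟙-≤-suc b       zero    = refl
𝟙-≤-suc zero    (suc n) = refl
𝟙-≤-suc (suc b) (suc n) = 𝟙-≤-suc b n

sumTo : (ℕ → ℕ) → ℕ → ℕ
sumTo f zero    = 0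
sumTo f (suc k) = sumTo f k + f (suc k)

sumTo-cong : ∀ {f g : ℕ → ℕ} → (∀ b → f b ≡ g b) → ∀ k → sumTo f k ≡ sumTo g k
sumTo-cong f≗g zero    = refl
sumTo-cong f≗g (suc k) = cong₂ _+_ (sumTo-cong f≗g k) (f≗g (suc k))

sumTo-constant-on : ∀ f x c v → (∀ b → x < b → b ≤ x + c → f b ≡ v) →
                    sumTo f (x + c) ≡ sumTo f x + c * v
sumTo-constant-on f x zero    v _     = trans (cong (sumTo f) (+-identityʳ x)) (sym (+-identityʳ _))
sumTo-constant-on f x (suc c) v const = begin
    sumTo f (x + suc c)                   ≡⟨ cong (sumTo f) (+-suc x c) ⟩
    sumTo f (x + c) + f (suc (x + c))     ≡⟨ cong₂ _+_ (sumTo-constant-on f x c v below) last ⟩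
    sumTo f x + c * v + v                 ≡⟨ +-assoc (sumTo f x) (c * v) v ⟩
    sumTo f x + (c * v + v)               ≡⟨ cong (sumTo f x +_) (+-comm (c * v) v) ⟩
    sumTo f x + suc c * v                 ∎
  where
  open ≡-Reasoning
  suc-x+c : suc (x + c) ≡ x + suc c
  suc-x+c = sym (+-suc x c)
  below : ∀ b → x < b → b ≤ x + c → f b ≡ v
  below b x<b b≤x+c = const b x<b (≤-trans (m≤n⇒m≤1+n b≤x+c) (≤-reflexive suc-x+c))
  last : f (suc (x + c)) ≡ v
  last = const (suc (x + c)) (s≤s (m≤m+n x c)) (≤-reflexive suc-x+c)

-- For monotone s, the b with s b ≤ n ≤ s b + b form an interval (x, x + c], so it
-- suffices to check the inequalities at its two ends.
sumTo-window : ∀ (s : ℕ → ℕ) → (∀ {a b} → a ≤ b → s a ≤ s b) → ∀ {n} x c {k} →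
               s x + x < n → n ≤ s (suc x) + suc x → s (x + c) ≤ n → n < s (suc (x + c)) →
               x + c ≤ k → sumTo (λ b → shift (s b) (λ r → 𝟙[ r ≤ b ]) n) k ≡ c
sumTo-window s mono {n} x c below-x at-x+1 at-x+c above-x+c x+c≤k
  with d , refl ← m≤n⇒∃[o]m+o≡n x+c≤k = begin
    sumTo f (x + c + d)                 ≡⟨ sumTo-constant-on f (x + c) d 0 after ⟩
    sumTo f (x + c) + d * 0             ≡⟨ cong (_+ d * 0) (sumTo-constant-on f x c 1 inside) ⟩
    sumTo f x + c * 1 + d * 0           ≡⟨ cong (λ z → z + c * 1 + d * 0) (sumTo-constant-on f 0 x 0 before) ⟩
    0 + x * 0 + c * 1 + d * 0           ≡⟨ solve (x ∷ c ∷ d ∷ []) ⟩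
    c                                   ∎
  where
  open ≡-Reasoning
  f : ℕ → ℕ
  f b = shift (s b) (λ r → 𝟙[ r ≤ b ]) n
  before : ∀ b → 0 < b → b ≤ x → f b ≡ 0
  before b _ b≤x = shift-𝟙-above (s b) b (≤-trans (s≤s (+-mono-≤ (mono b≤x) b≤x)) below-x)
  inside : ∀ b → x < b → b ≤ x + c → f b ≡ 1
  inside b x<b b≤x+c = shift-𝟙-inside (s b) b (≤-trans (mono b≤x+c) at-x+c) (≤-trans at-x+1 (+-mono-≤ (mono x<b) x<b))
  after : ∀ b → x + c < b → b ≤ x + c + d → f b ≡ 0
  after b x+c<b _ = shift-below (s b) _ (≤-trans above-x+c (mono x+c<b))

countSum : List (List ℕ) → ℕ → ℕ
countSum xss n = length (filter (λ xs → sum xs ≟ n) xss)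

length-filter-map : ∀ {A B : Set} {P : B → Set} (P? : Decidable P) (f : A → B) xs →
                    length (filter P? (map f xs)) ≡ length (filter (P? ∘ f) xs)
length-filter-map P? f []       = refl
length-filter-map P? f (x ∷ xs) with does (P? (f x))
... | true  = cong suc (length-filter-map P? f xs)
... | false = length-filter-map P? f xs

countSum-++ : ∀ xss yss n → countSum (xss ++ yss) n ≡ countSum xss n + countSum yss n
countSum-++ xss yss n =
  trans (cong length (filter-++ (λ xs → sum xs ≟ n) xss yss)) (length-++ (filter (λ xs → sum xs ≟ n) xss))

countSum-[[]] : ∀ n → countSum ([] ∷ []) n ≡ 𝟙[ n ≤ 0 ]
countSum-[[]] zero    = refl
countSum-[[]] (suc n) = refl

countSum-offset : ∀ a xss n → length (filter (λ xs → a + sum xs ≟ n) xss) ≡ shift a (countSum xss) n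
countSum-offset zero    xss zero    = refl
countSum-offset zero    xss (suc n) = refl
countSum-offset (suc a) xss zero    = cong length (filter-none (λ xs → suc a + sum xs ≟ 0) (universal (λ _ ()) xss))
countSum-offset (suc a) xss (suc n) =
  trans (cong length (filter-≐ (λ xs → suc a + sum xs ≟ suc n) (λ xs → a + sum xs ≟ n) (suc-injective , cong suc) xss))
        (countSum-offset a xss n)

countSum-prepend : ∀ a xss n → countSum (map (a ∷_) xss) n ≡ shift a (countSum xss) n
countSum-prepend a xss n =
  trans (length-filter-map (λ xs → sum xs ≟ n) (a ∷_) xss) (countSum-offset a xss n)

p-zero-parts : ∀ k n → p k 0 n ≡ 𝟙[ n ≤ 0 ]
p-zero-parts k = countSum-[[]]

p-zero-bound : ∀ j n → p 0 (suc j) n ≡ 𝟙[ n ≤ 0 ]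
p-zero-bound j = countSum-[[]]

p-largest : ∀ k j n → p (suc k) (suc j) n ≡ p k (suc j) n + shift (suc k) (p (suc k) j) n
p-largest k j n = begin
    countSum ([] ∷ concatMap g (upTo (suc k))) n
  ≡⟨ cong (λ is → countSum ([] ∷ concatMap g is) n) (sym (upTo-∷ʳ k)) ⟩
    countSum ([] ∷ concatMap g (upTo k ++ [ k ])) n
  ≡⟨ cong (λ xss → countSum ([] ∷ xss) n) (concatMap-++ g (upTo k) [ k ]) ⟩
    countSum (([] ∷ concatMap g (upTo k)) ++ (g k ++ [])) n
  ≡⟨ countSum-++ ([] ∷ concatMap g (upTo k)) (g k ++ []) n ⟩
    p k (suc j) n + countSum (g k ++ []) n
  ≡⟨ cong (λ xss → p k (suc j) n + countSum xss n) (++-identityʳ (g k)) ⟩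
    p k (suc j) n + countSum (map (suc k ∷_) (boundedLists (suc k) j)) n
  ≡⟨ cong (p k (suc j) n +_) (countSum-prepend (suc k) (boundedLists (suc k) j) n) ⟩
    p k (suc j) n + shift (suc k) (p (suc k) j) n
  ∎
  where
  open ≡-Reasoning
  g : ℕ → List (List ℕ)
  g i = map (suc i ∷_) (boundedLists (suc i) j)

p-sum-over-largest : ∀ k j n → p k (suc j) n ≡ 𝟙[ n ≤ 0 ] + sumTo (λ b → shift b (p b j) n) k
p-sum-over-largest zero    j n = trans (p-zero-bound j n) (sym (+-identityʳ _))
p-sum-over-largest (suc k) j n = begin
    p (suc k) (suc j) n                                                  ≡⟨ p-largest k j n ⟩
    p k (suc j) n + shift (suc k) (p (suc k) j) n                        ≡⟨ cong (_+ shift (suc k) (p (suc k) j) n) (p-sum-over-largest k j n) ⟩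
    𝟙[ n ≤ 0 ] + sumTo (λ b → shift b (p b j) n) k + shift (suc k) (p (suc k) j) n
                                                                         ≡⟨ +-assoc 𝟙[ n ≤ 0 ] _ _ ⟩
    𝟙[ n ≤ 0 ] + sumTo (λ b → shift b (p b j) n) (suc k)                 ∎
  where open ≡-Reasoning

p-one-part : ∀ b n → p b 1 n ≡ 𝟙[ n ≤ b ]
p-one-part zero    n = p-zero-bound 0 n
p-one-part (suc b) n = begin
    p (suc b) 1 n                                                ≡⟨ p-largest b 0 n ⟩
    p b 1 n + shift (suc b) (p (suc b) 0) n                      ≡⟨ cong₂ _+_ (p-one-part b n) (shift-cong (suc b) (p-zero-parts (suc b)) n) ⟩
    𝟙[ n ≤ b ] + shift (suc b) (λ m → 𝟙[ m ≤ 0 ]) n              ≡⟨ 𝟙-≤-suc b n ⟩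
    𝟙[ n ≤ suc b ]                                               ∎
  where open ≡-Reasoning

p-of-zero : ∀ k j → p k j 0 ≡ 1
p-of-zero k       zero    = refl
p-of-zero zero    (suc j) = refl
p-of-zero (suc k) (suc j) = trans (p-largest k j 0) (trans (+-identityʳ _) (p-of-zero k (suc j)))

-- pTie k j n counts the partitions of n into at most j + 2 parts, each at most k, whose
-- two largest parts are equal (to some b ≥ 1); the remaining parts form a partition of
-- n − 2b into at most j parts, each at most b.
pTie : ℕ → ℕ → ℕ → ℕ
pTie k j n = sumTo (λ b → shift (b + b) (p b j) n) k

-- Raising the largest part by one maps the partitions of n whose largest part is < k
-- bijectively onto the partitions of n + 1 whose largest part is unique;
-- shift k (p k (suc j)) n counts the partitions of n with largest part k.
p-raise-largest : ∀ k j n → p k (2 + j) (suc n) + shift k (p k (suc j)) n ≡ p k (2 + j) n + pTie k j (suc n)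
p-raise-largest zero    j n = begin
    p 0 (2 + j) (suc n) + p 0 (suc j) n     ≡⟨ cong₂ _+_ (p-zero-bound (suc j) (suc n)) (p-zero-bound j n) ⟩
    𝟙[ n ≤ 0 ]                             ≡⟨ sym (+-identityʳ _) ⟩
    𝟙[ n ≤ 0 ] + 0                         ≡⟨ cong (_+ 0) (sym (p-zero-bound (suc j) n)) ⟩
    p 0 (2 + j) n + 0                      ∎
  where open ≡-Reasoning
p-raise-largest (suc k) j n = begin
    p (suc k) (2 + j) (suc n) + shift (suc k) P n
  ≡⟨ cong (_+ shift (suc k) P n) (p-largest k (suc j) (suc n)) ⟩
    p k (2 + j) (suc n) + shift k P n + shift (suc k) P n
  ≡⟨ cong (λ z → p k (2 + j) (suc n) + z + shift (suc k) P n) largest-below-k ⟩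
    p k (2 + j) (suc n) + (shift k (p k (suc j)) n + shift (k + suc k) Q n) + shift (suc k) P n
  ≡⟨ cong (_+ shift (suc k) P n) (sym (+-assoc (p k (2 + j) (suc n)) (shift k (p k (suc j)) n) _)) ⟩
    p k (2 + j) (suc n) + shift k (p k (suc j)) n + shift (k + suc k) Q n + shift (suc k) P n
  ≡⟨ cong (λ z → z + shift (k + suc k) Q n + shift (suc k) P n) (p-raise-largest k j n) ⟩
    p k (2 + j) n + pTie k j (suc n) + shift (k + suc k) Q n + shift (suc k) P n
  ≡⟨ regroup (p k (2 + j) n) (pTie k j (suc n)) _ _ ⟩
    p k (2 + j) n + shift (suc k) P n + (pTie k j (suc n) + shift (k + suc k) Q n)
  ≡⟨ cong (_+ pTie (suc k) j (suc n)) (sym (p-largest k (suc j) n)) ⟩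
    p (suc k) (2 + j) n + pTie (suc k) j (suc n)
  ∎
  where
  open ≡-Reasoning
  P Q : ℕ → ℕ
  P = p (suc k) (suc j)
  Q = p (suc k) j
  largest-below-k : shift k P n ≡ shift k (p k (suc j)) n + shift (k + suc k) Q n
  largest-below-k = begin
    shift k P n                                                ≡⟨ shift-cong k (p-largest k j) n ⟩
    shift k (λ m → p k (suc j) m + shift (suc k) Q m) n        ≡⟨ shift-+ k (p k (suc j)) (shift (suc k) Q) n ⟩
    shift k (p k (suc j)) n + shift k (shift (suc k) Q) n      ≡⟨ cong (shift k (p k (suc j)) n +_) (shift-shift k (suc k) Q n) ⟩
    shift k (p k (suc j)) n + shift (k + suc k) Q n            ∎
  regroup : ∀ a b c d → a + b + c + d ≡ a + d + (b + c)
  regroup = solve-∀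

p-three-succ : ∀ k r a → a + p k 2 r ≡ pTie k 1 (suc (k + r)) → p k 3 (suc (k + r)) ≡ p k 3 (k + r) + a
p-three-succ k r a balance = +-cancelʳ-≡ (p k 2 r) _ _ (begin
    p k 3 (suc (k + r)) + p k 2 r                ≡⟨ cong (p k 3 (suc (k + r)) +_) (sym (shift-at k (p k 2) r)) ⟩
    p k 3 (suc (k + r)) + shift k (p k 2) (k + r) ≡⟨ p-raise-largest k 1 (k + r) ⟩
    p k 3 (k + r) + pTie k 1 (suc (k + r))       ≡⟨ cong (p k 3 (k + r) +_) (sym balance) ⟩
    p k 3 (k + r) + (a + p k 2 r)                ≡⟨ sym (+-assoc (p k 3 (k + r)) a (p k 2 r)) ⟩
    p k 3 (k + r) + a + p k 2 r                  ∎)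
  where open ≡-Reasoning

m+o≡n⇒m≤n : ∀ {m n} o → m + o ≡ n → m ≤ n
m+o≡n⇒m≤n {m} o refl = m≤m+n m o

p-two-parts : ∀ k n → p k 2 n ≡ 𝟙[ n ≤ 0 ] + sumTo (λ b → shift b (λ r → 𝟙[ r ≤ b ]) n) k
p-two-parts k n =
  trans (p-sum-over-largest k 1 n) (cong (𝟙[ n ≤ 0 ] +_) (sumTo-cong (λ b → shift-cong b (p-one-part b) n) k))

pTie-one : ∀ k n → pTie k 1 n ≡ sumTo (λ b → shift (b + b) (λ r → 𝟙[ r ≤ b ]) n) k
pTie-one k n = sumTo-cong (λ b → shift-cong (b + b) (p-one-part b) n) k

p-two-parts-odd : ∀ t k → suc (2 * t) ≤ k → p k 2 (suc (2 * t)) ≡ suc t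
p-two-parts-odd t k 2t+1≤k = trans (p-two-parts k (suc (2 * t)))
  (sumTo-window (λ b → b) (λ a≤b → a≤b) {suc (2 * t)} t (suc t) {k}
    (≤-reflexive (solve (t ∷ [])))
    (m+o≡n⇒m≤n 1 (solve (t ∷ [])))
    (≤-reflexive (solve (t ∷ [])))
    (≤-reflexive (solve (t ∷ [])))
    (≤-trans {j = suc (2 * t)} (≤-reflexive (solve (t ∷ []))) 2t+1≤k))

p-two-parts-even : ∀ t k → 2 * t ≤ k → p k 2 (2 * t) ≡ suc t
p-two-parts-even zero    k _      = p-of-zero k 2
p-two-parts-even (suc u) k 2t≤k = trans (p-two-parts k (2 * suc u))
  (sumTo-window (λ b → b) (λ a≤b → a≤b) {2 * suc u} u (suc (suc u)) {k}
    (m+o≡n⇒m≤n 1 (solve (u ∷ [])))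
    (≤-reflexive (solve (u ∷ [])))
    (≤-reflexive (solve (u ∷ [])))
    (≤-reflexive (solve (u ∷ [])))
    (≤-trans {j = 2 * suc u} (≤-reflexive (solve (u ∷ []))) 2t≤k))

pTie-one-at-6t+6 : ∀ t k → 3 * suc t ≤ k → pTie k 1 (6 * suc t) ≡ suc (suc t)
pTie-one-at-6t+6 t k 3t+3≤k = trans (pTie-one k (6 * suc t))
  (sumTo-window (λ b → b + b) (λ a≤b → +-mono-≤ a≤b a≤b) {6 * suc t} (suc (2 * t)) (suc (suc t)) {k}
    (m+o≡n⇒m≤n 2 (solve (t ∷ [])))
    (≤-reflexive (solve (t ∷ [])))
    (≤-reflexive (solve (t ∷ [])))
    (m+o≡n⇒m≤n 1 (solve (t ∷ [])))
    (≤-trans {j = 3 * suc t} (≤-reflexive (solve (t ∷ []))) 3t+3≤k))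

pTie-one-at-6t+3 : ∀ t k → 3 * t + 1 ≤ k → pTie k 1 (6 * t + 3) ≡ suc t
pTie-one-at-6t+3 t k 3t+1≤k = trans (pTie-one k (6 * t + 3))
  (sumTo-window (λ b → b + b) (λ a≤b → +-mono-≤ a≤b a≤b) {6 * t + 3} (2 * t) (suc t) {k}
    (m+o≡n⇒m≤n 2 (solve (t ∷ [])))
    (≤-reflexive (solve (t ∷ [])))
    (m+o≡n⇒m≤n 1 (solve (t ∷ [])))
    (≤-reflexive (solve (t ∷ [])))
    (≤-trans {j = 3 * t + 1} (≤-reflexive (solve (t ∷ []))) 3t+1≤k))

centre-balance : ∀ t → 1 + p (4 * suc t) 2 (suc (2 * t)) ≡ pTie (4 * suc t) 1 (suc (4 * suc t + suc (2 * t)))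
centre-balance t = begin
    1 + p (4 * suc t) 2 (suc (2 * t))
  ≡⟨ cong suc (p-two-parts-odd t (4 * suc t) (m+o≡n⇒m≤n (2 * t + 3) (solve (t ∷ [])))) ⟩
    suc (suc t)
  ≡⟨ sym (pTie-one-at-6t+6 t (4 * suc t) (m+o≡n⇒m≤n (suc t) (solve (t ∷ [])))) ⟩
    pTie (4 * suc t) 1 (6 * suc t)
  ≡⟨ cong (pTie (4 * suc t) 1) (solve (t ∷ [])) ⟩
    pTie (4 * suc t) 1 (suc (4 * suc t + suc (2 * t)))
  ∎
  where open ≡-Reasoning

off-centre-balance : ∀ t → 0 + p (4 * t + 2) 2 (2 * t) ≡ pTie (4 * t + 2) 1 (suc (4 * t + 2 + 2 * t))
off-centre-balance t = begin
    p (4 * t + 2) 2 (2 * t)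
  ≡⟨ p-two-parts-even t (4 * t + 2) (m+o≡n⇒m≤n (2 * t + 2) (solve (t ∷ []))) ⟩
    suc t
  ≡⟨ sym (pTie-one-at-6t+3 t (4 * t + 2) (m+o≡n⇒m≤n (t + 1) (solve (t ∷ [])))) ⟩
    pTie (4 * t + 2) 1 (6 * t + 3)
  ≡⟨ cong (pTie (4 * t + 2) 1) (solve (t ∷ [])) ⟩
    pTie (4 * t + 2) 1 (suc (4 * t + 2 + 2 * t))
  ∎
  where open ≡-Reasoning

corollary3p3 : (ℓ : ℕ) → 1 Data.Nat.≤ ℓ →
    (p (4 * ℓ) 3 (6 * ℓ) ≡ p (4 * ℓ) 3 (6 * ℓ ∸ 1) + 1)
      × (p (4 * ℓ ∸ 2) 3 (6 * ℓ ∸ 3) ≡ p (4 * ℓ ∸ 2) 3 (6 * ℓ ∸ 4))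
corollary3p3 (suc t) _ = centre , off-centre
  where
  six-centre : 6 * suc t ≡ suc (4 * suc t + suc (2 * t))
  six-centre = solve (t ∷ [])
  four-off-centre : 4 * suc t ≡ 2 + (4 * t + 2)
  four-off-centre = solve (t ∷ [])
  six-off-centre : 6 * suc t ≡ 4 + (4 * t + 2 + 2 * t)
  six-off-centre = solve (t ∷ [])
  centre : p (4 * suc t) 3 (6 * suc t) ≡ p (4 * suc t) 3 (6 * suc t ∸ 1) + 1
  centre = subst (λ n → p (4 * suc t) 3 n ≡ p (4 * suc t) 3 (n ∸ 1) + 1) (sym six-centre)
    (p-three-succ (4 * suc t) (suc (2 * t)) 1 (centre-balance t))
  off-centre : p (4 * suc t ∸ 2) 3 (6 * suc t ∸ 3) ≡ p (4 * suc t ∸ 2) 3 (6 * suc t ∸ 4)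
  off-centre = subst₂ (λ k n → p (k ∸ 2) 3 (n ∸ 3) ≡ p (k ∸ 2) 3 (n ∸ 4)) (sym four-off-centre) (sym six-off-centre)
    (trans (p-three-succ (4 * t + 2) (2 * t) 0 (off-centre-balance t)) (+-identityʳ _))
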